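{- Let $\Gamma$ be a simple assembly graph with exactly $n$ vertices of degree $4$, labelled $1,\dots,n$, let $w_\Gamma$ be the double occurrence word over $\{1,\dots,n\}$ obtained along its Eulerian transversal, and let $e_1,\dots,e_{2n-1}$ be the enumerated edges of the transversal. Then the following are equivalent: (1) $|\mathcal{C}(\Gamma)|=F_{2n+1}-1$; (2) for every $1\le k\le n-1$, any $k$ pairwise non-consecutive edges $e_{i_1},\dots,e_{i_k}$ (together with their incident vertices) form a vertex-disjoint set of polygonal paths; (3) for every $1\le k\le n-1$ and any $k$ pairwise non-consecutive edges $e_{i_1},\dots,e_{i_k}$, some vertex of $\Gamma$ occurs exactly once in the sequence $(v_1(e_{i_1}),v_2(e_{i_1}),\dots,v_1(e_{i_k}),v_2(e_{i_k}))$; (4) for every proper non-empty subset $\sigma\subset\{1,\dots,n\}$, at least one word in $w_\Gamma\setminus\sigma$ has odd length.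
   Context: An assembly graph is a finite connected graph (loops and multiple edges allowed) in which every vertex has degree $1$ or $4$ (a loop contributes $2$ to the degree), and at every degree-$4$ vertex a cyclic order (up to reversal) of its four incident half-edges is fixed; two half-edges at a vertex are neighbours if adjacent in this cyclic order. A transverse path is a path between two degree-$1$ vertices with pairwise distinct edges such that at each intermediate vertex the entering and leaving half-edges are not neighbours. A simple assembly graph has a transverse path traversing every edge exactly once (Eulerian transversal). Writing the degree-$4$ vertices in the order visited gives $w_\Gamma$ of length $2n$; the edges are enumerated by $e_i=(w_\Gamma[i],w_\Gamma[i+1])$, $i=1,\dots,2n-1$, i.e. $e_i$ is the transversal edge between its $i$-th and $(i+1)$-th visits to degree-$4$ vertices (edges at degree-$1$ vertices are not enumerated). Edges $e_i,e_j$ are consecutive if $|i-j|=1$. For an edge $e$, $v_1(e),v_2(e)$ are its two end vertices (equal if $e$ is a loop). A polygonal path is a path $v_0e_1v_1\dots e_\ell v_\ell$ ($\ell\ge0$) with pairwise distinct degree-$4$ vertices such that $e_i,e_{i+1}$ are neighbours at $v_i$; a single vertex is a polygonal path. A Hamiltonian set of polygonal paths is a set of pairwise vertex-disjoint polygonal paths covering all degree-$4$ vertices; $\mathcal{C}(\Gamma)$ is the collection of these. $F_k$ denotes Fibonacci numbers ($F_0=0,F_1=1$). For a word $w$ and letter set $\sigma$, $w\setminus\sigma$ is the sequence of non-empty maximal subwords of $w$ containing no letter of $\sigma$. -}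

module Defs where

open import Data.Nat using (ℕ; zero; suc; _+_; _*_; _∸_; _≤_; _<_; _%_)
open import Data.Fin using (Fin; inject₁; toℕ; _≟_) renaming (suc to fsuc)
open import Data.Fin.Subset using (Subset; _∈_; _∉_; Nonempty)
open import Data.Fin.Subset.Properties using (_∈?_)
open import Data.List using (List; []; _∷_; map; length; wordsBy; filter; concatMap; tabulate)
open import Data.List.Membership.Propositional using () renaming (_∈_ to _∈ₗ_)
open import Data.List.Relation.Unary.Any using (Any)
open import Data.List.Relation.Unary.AllPairs using (AllPairs)
open import Data.List.Relation.Unary.Unique.Propositional using (Unique)
open import Data.List.Relation.Binary.Disjoint.Propositional using (Disjoint)
open import Data.Product using (Σ; ∃; _×_; _,_; proj₁; proj₂)
open import Data.Sum using (_⊎_)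
open import Data.Unit using (⊤)
open import Relation.Binary.PropositionalEquality using (_≡_; _≢_)
open import Function.Bundles using (_⇔_)

fib : ℕ → ℕ
fib 0 = 0
fib 1 = 1
fib (suc (suc m)) = fib (suc m) + fib m

DoubleOccurrence : {k n : ℕ} → (Fin (suc k) → Fin n) → Set
DoubleOccurrence {k} {n} w =
  ∀ (v : Fin n) → Σ (Fin (suc k)) λ p → Σ (Fin (suc k)) λ q →
    p ≢ q × w p ≡ v × w q ≡ v × (∀ r → w r ≡ v → r ≡ p ⊎ r ≡ q)

-- The simple assembly graph Γ with Eulerian transversal w (length suc k = 2n).
-- Enumerated edges: e : Fin k (0-indexed), e joins the visit at position
-- inject₁ e (its outgoing half-edge there) and the visit at position suc e
-- (its incoming half-edge there).  At a vertex v visited at positions p ≠ q,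
-- the cyclic order of half-edges is (in_p, ·, out_p, ·) with the half-edges of
-- visit q in between (transversality), so two half-edges at v are neighbours
-- iff they belong to different visits (different positions).
module Graph {k n : ℕ} (w : Fin (suc k) → Fin n) where

  Joins : Fin k → Fin n → Fin n → Set
  Joins e u v = (w (inject₁ e) ≡ u × w (fsuc e) ≡ v) ⊎ (w (inject₁ e) ≡ v × w (fsuc e) ≡ u)

  Incident : Fin k → Fin n → Set
  Incident e v = w (inject₁ e) ≡ v ⊎ w (fsuc e) ≡ v

  EndAt : Fin k → Fin n → Fin (suc k) → Set
  EndAt e v p = (p ≡ inject₁ e ⊎ p ≡ fsuc e) × w p ≡ v

  Neighbours : Fin n → Fin k → Fin k → Set
  Neighbours v e e' = ∀ p q → EndAt e v p → EndAt e' v q → p ≢ q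

  -- a walk v₀ e₁ v₁ … e_ℓ v_ℓ given by v₀ and the steps (eᵢ , vᵢ);
  -- consecutive edges are neighbours at the intermediate vertex
  Chain : Fin n → List (Fin k × Fin n) → Set
  Chain v [] = ⊤
  Chain v ((e , u) ∷ []) = Joins e v u
  Chain v ((e , u) ∷ (e' , u') ∷ rest) =
    Joins e v u × Neighbours u e e' × Chain u ((e' , u') ∷ rest)

  record PolygonalPath : Set where
    field
      start : Fin n
      steps : List (Fin k × Fin n)
      chain : Chain start steps
      distinct : Unique (start ∷ map proj₂ steps)

  open PolygonalPath public

  verts : PolygonalPath → List (Fin n)
  verts P = start P ∷ map proj₂ (steps P)

  edges : PolygonalPath → List (Fin k)
  edges P = map proj₁ (steps P)

  VertexDisjoint : List PolygonalPath → Set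
  VertexDisjoint = AllPairs (λ P Q → Disjoint (verts P) (verts Q))

  Hamiltonian : List PolygonalPath → Set
  Hamiltonian H = VertexDisjoint H × (∀ v → Any (λ P → v ∈ₗ verts P) H)

  -- S is the edge set of some Hamiltonian set of polygonal paths
  -- (a Hamiltonian set is determined by its edge set, so elements of C(Γ)
  -- are identified with their edge sets)
  HamiltonianEdgeSet : Subset k → Set
  HamiltonianEdgeSet S = Σ (List PolygonalPath) λ H →
    Hamiltonian H × (∀ e → (e ∈ S) ⇔ Any (λ P → e ∈ₗ edges P) H)

  CardC : ℕ → Set
  CardC N = Σ (List (Subset k)) λ L →
    Unique L × (∀ S → (S ∈ₗ L) ⇔ HamiltonianEdgeSet S) × length L ≡ N

  Apart : Fin k → Fin k → Set
  Apart a b = suc (toℕ a) < toℕ b ⊎ suc (toℕ b) < toℕ a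

  NonConsecutive : ℕ → List (Fin k) → Set
  NonConsecutive m E = AllPairs Apart E × length E ≡ m

  FormPaths : List (Fin k) → Set
  FormPaths E = Σ (List PolygonalPath) λ H →
    VertexDisjoint H
    × (∀ e → (e ∈ₗ E) ⇔ Any (λ P → e ∈ₗ edges P) H)
    × (∀ v → Any (λ P → v ∈ₗ verts P) H ⇔ Any (λ e → Incident e v) E)

  endSeq : List (Fin k) → List (Fin n)
  endSeq = concatMap (λ e → w (inject₁ e) ∷ w (fsuc e) ∷ [])

  occurrences : Fin n → List (Fin n) → ℕ
  occurrences v xs = length (filter (_≟ v) xs)

  word : List (Fin n)
  word = tabulate w

  deleteLetters : Subset n → List (List (Fin n))
  deleteLetters σ = wordsBy (_∈? σ) word

  Cond1 : Set
  Cond1 = CardC (fib (2 * n + 1) ∸ 1)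

  Cond2 : Set
  Cond2 = ∀ m → 1 ≤ m → m ≤ n ∸ 1 → ∀ E → NonConsecutive m E → FormPaths E

  Cond3 : Set
  Cond3 = ∀ m → 1 ≤ m → m ≤ n ∸ 1 → ∀ E → NonConsecutive m E →
    ∃ λ v → occurrences v (endSeq E) ≡ 1

  Cond4 : Set
  Cond4 = ∀ (σ : Subset n) → Nonempty σ → (∃ λ v → v ∉ σ) →
    Any (λ s → length s % 2 ≡ 1) (deleteLetters σ)

-- Number the positions of the transversal 0, …, 2n-1, so that the edge eᵢ is a domino on the
-- positions i-1 and i.  Consecutive edges share a position, whereas the two edges of a
-- polygonal path at a vertex occupy its two different positions; so the edge set of a
-- Hamiltonian set of paths contains no two consecutive edges.  Nor is it the perfect matching
-- {e₁, e₃, …, e_{2n-1}}: that matching uses both occurrences of every vertex, while the first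
-- vertex of a path with an edge is used only once.  The other F_{2n+1} - 1 sets of pairwise
-- non-consecutive edges have at most n-1 edges, so (1) says exactly that each of them forms
-- polygonal paths, and the first-vertex argument gives (2) ⇒ (3).  Conversely, a vertex
-- occurring once is the free end of one of the edges, and the paths formed by the remaining
-- edges extend along it, which gives (3) ⇒ (2).  Finally, all words of w ∖ σ have even length
-- exactly when the occurrences of the letters outside σ can be tiled by pairwise
-- non-consecutive edges, and the ends of such a tiling contain both occurrences of each of
-- their vertices; this links (3) and (4).
module Submission where

open import Defs
open import Data.Nat using (ℕ; suc; _*_)
open import Data.Fin using (Fin)
open import Data.Product using (_×_)
open import Function.Bundles using (_⇔_)
open import Relation.Binary.PropositionalEquality using (_≡_)

open import Level using (0ℓ)
open import Data.Bool as Bool using (Bool; true; false)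
open import Data.Empty using (⊥; ⊥-elim)
open import Data.Unit using (tt)
open import Data.Nat using (zero; _+_; _∸_; _≤_; _<_; _%_; z≤n; s≤s) renaming (_≟_ to _≟ℕ_)
open import Data.Nat.Properties
  using (module ≤-Reasoning; ≤-refl; ≤-reflexive; ≤-trans; ≤-antisym; <-irrefl; >⇒≢; <⇒≤pred; n≤1+n;
         m≤n⇒m≤1+n; 1+n≢n; suc-injective; +-comm; *-suc; *-cancelˡ-≤; *-cancelˡ-<; even≢odd)
open import Data.Fin using (toℕ; inject₁; zero; _≟_) renaming (suc to fsuc)
open import Data.Fin.Properties using (toℕ-inject₁; any?) renaming (suc-injective to fsuc-injective)
open import Data.Fin.Subset
  using (Subset; inside; outside; ⁅_⁆; _∪_; ∣_∣; Nonempty) renaming (_∈_ to _∈ₛ_; _∉_ to _∉ₛ_; ⊥ to ∅)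
open import Data.Fin.Subset.Properties using (∉⊥; ∪⇔⊎; x∈⁅y⁆⇔x≡y; nonempty?) renaming (_∈?_ to _∈ₛ?_)
import Data.Vec.Base as Vec
open import Data.Vec.Base using ([]; _∷_)
open import Data.Vec.Properties using (≡-dec)
open import Data.List using (List; []; _∷_; length; map; filter; reverse; wordsBy; _++_; tabulate; allFin)
open import Data.List.Properties
  using (length-++; length-map; length-reverse; length-tabulate; map-++; map-tabulate;
         filter-notAll; filter-some; filter-none; filter-all; filter-reject; filter-accept)
open import Data.List.Relation.Unary.All using (All; []; _∷_)
import Data.List.Relation.Unary.All as All
import Data.List.Relation.Unary.All.Properties as All
open import Data.List.Relation.Unary.Any using (Any; here; there)
import Data.List.Relation.Unary.Any as Any
import Data.List.Relation.Unary.Any.Properties as Any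
open import Data.List.Relation.Unary.AllPairs using (AllPairs; []; _∷_)
import Data.List.Relation.Unary.AllPairs as AllPairs
import Data.List.Relation.Unary.AllPairs.Properties as AllPairs
open import Data.List.Relation.Unary.Unique.Propositional using (Unique)
import Data.List.Relation.Unary.Unique.Propositional.Properties as Unique
open import Data.List.Membership.Propositional using (_∈_; _∉_; find; lose)
open import Data.List.Membership.Propositional.Properties using (∈-filter⁺; ∈-filter⁻; ∈-∃++; ∈-allFin; ∈-map⁺; ∈-map⁻)
open import Data.List.Relation.Binary.Subset.Propositional using (_⊆_)
open import Data.List.Relation.Binary.Disjoint.Propositional using (Disjoint)
import Data.List.Relation.Binary.Disjoint.Propositional.Properties as Disjoint
open import Data.List.Relation.Binary.Permutation.Propositional using (_↭_; ↭-refl; ↭-sym; ↭-trans; ↭-reflexive; ↭⇒↭ₛ)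
open import Data.List.Relation.Binary.Permutation.Propositional.Properties using (∷↭∷ʳ; shift; ∈-resp-↭; Any-resp-↭)
import Data.List.Relation.Binary.Permutation.Setoid.Properties as PermutationSetoid
open import Data.Product using (Σ; ∃; _,_; proj₁; proj₂)
open import Data.Sum using (_⊎_; inj₁; inj₂; swap; [_,_]′; map₂)
open import Function.Base using (id; _∘_; _∋_)
open import Function.Bundles using (mk⇔; module Equivalence)
open import Function.Construct.Composition using (_⇔-∘_)
open import Function.Construct.Symmetry using (⇔-sym)
open import Relation.Binary.Definitions using (DecidableEquality)
open import Relation.Binary.PropositionalEquality
  using (refl; sym; trans; cong; cong₂; subst; setoid; resp₂; module ≡-Reasoning)
open import Relation.Nullary using (¬_; Dec; does; yes; no; ¬?; contradiction)
open import Relation.Nullary.Decidable using (decidable-stable)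
open import Relation.Unary using (Pred; Decidable)

open Equivalence using (to; from)

module _ {A : Set} (_≟_ : DecidableEquality A) where

  remove : A → List A → List A
  remove x = filter (λ y → ¬? (y ≟ x))

  ∈-remove⁻ : ∀ {x y xs} → y ∈ remove x xs → y ∈ xs × ¬ y ≡ x
  ∈-remove⁻ {x} = ∈-filter⁻ (λ y → ¬? (y ≟ x))

  ∈-remove⁺ : ∀ {x y xs} → y ∈ xs → ¬ y ≡ x → y ∈ remove x xs
  ∈-remove⁺ {x} = ∈-filter⁺ (λ y → ¬? (y ≟ x))

  ∷-remove : ∀ {x xs} → x ∈ xs → ∀ {y} → y ∈ x ∷ remove x xs ⇔ y ∈ xs
  ∷-remove {x} {xs} x∈xs {y} = mk⇔ (λ { (here refl) → x∈xs ; (there y∈) → proj₁ (∈-remove⁻ y∈) }) back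
    where
    back : y ∈ xs → y ∈ x ∷ remove x xs
    back y∈xs with y ≟ x
    ... | yes refl = here refl
    ... | no y≢x = there (∈-remove⁺ y∈xs y≢x)

  length-remove : ∀ {x xs} → Unique xs → x ∈ xs → suc (length (remove x xs)) ≡ length xs
  length-remove {x} (x∉xs ∷ _) (here refl) =
    cong (suc ∘ length) (trans (filter-reject (λ y → ¬? (y ≟ x)) (λ x≢x → x≢x refl))
                               (filter-all (λ y → ¬? (y ≟ x)) (All.map (λ x≢y y≡x → x≢y (sym y≡x)) x∉xs)))
  length-remove {x} (y∉xs ∷ uxs) (there x∈xs) =
    trans (cong (suc ∘ length) (filter-accept (λ z → ¬? (z ≟ x)) (All.lookup y∉xs x∈xs)))
          (cong suc (length-remove uxs x∈xs))

  length-≤-⊆ : ∀ {xs ys : List A} → Unique xs → xs ⊆ ys → length xs ≤ length ys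
  length-≤-⊆ {[]} _ _ = z≤n
  length-≤-⊆ {x ∷ xs} {ys} (x∉xs ∷ uxs) xs⊆ys = ≤-trans (s≤s (length-≤-⊆ uxs xs⊆ys-x)) shorter
    where
    xs⊆ys-x : xs ⊆ remove x ys
    xs⊆ys-x z∈xs = ∈-remove⁺ (xs⊆ys (there z∈xs)) (All.lookup x∉xs z∈xs ∘ sym)
    shorter : length (remove x ys) < length ys
    shorter = filter-notAll (λ y → ¬? (y ≟ x)) ys (Any.map (λ x≡y y≢x → y≢x (sym x≡y)) (xs⊆ys (here refl)))

  ⊇-by-length : ∀ {xs ys : List A} → Unique xs → xs ⊆ ys → length ys ≤ length xs → ys ⊆ xs
  ⊇-by-length {xs} {ys} uxs xs⊆ys ys≤xs {y} y∈ys with Any.any? (y ≟_) xs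
  ... | yes y∈xs = y∈xs
  ... | no y∉xs = contradiction (≤-trans (length-≤-⊆ (All.¬Any⇒All¬ xs y∉xs ∷ uxs) y∷xs⊆ys) ys≤xs) (<-irrefl refl)
    where
    y∷xs⊆ys : (y ∷ xs) ⊆ ys
    y∷xs⊆ys (here refl) = y∈ys
    y∷xs⊆ys (there z∈xs) = xs⊆ys z∈xs

module _ {A : Set} where

  head∉ : ∀ {x : A} {xs} → Unique (x ∷ xs) → x ∉ xs
  head∉ (x∉xs ∷ _) = All.All¬⇒¬Any x∉xs

  ∈⇒1≤length : ∀ {x : A} {xs} → x ∈ xs → 1 ≤ length xs
  ∈⇒1≤length {xs = _ ∷ _} _ = s≤s z≤n

  1≤length⇒∈ : ∀ {xs : List A} {m} → 1 ≤ m → length xs ≡ m → ∃ λ x → x ∈ xs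
  1≤length⇒∈ {xs = x ∷ _} _ _ = x , here refl
  1≤length⇒∈ {xs = []} (s≤s _) ()

  allPairs-∈ : ∀ {R : A → A → Set} {xs x y} → AllPairs R xs → x ∈ xs → y ∈ xs → x ≡ y ⊎ R x y ⊎ R y x
  allPairs-∈ (_ ∷ _) (here refl) (here refl) = inj₁ refl
  allPairs-∈ (Rx ∷ _) (here refl) (there y∈) = inj₂ (inj₁ (All.lookup Rx y∈))
  allPairs-∈ (Rx ∷ _) (there x∈) (here refl) = inj₂ (inj₂ (All.lookup Rx x∈))
  allPairs-∈ (_ ∷ Rxs) (there x∈) (there y∈) = allPairs-∈ Rxs x∈ y∈

  disjoint-meet : ∀ {B : Set} {f : A → List B} {b} {P Q : A → Set} {xs} →
                  AllPairs (λ x y → Disjoint (f x) (f y)) xs →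
                  Any (λ x → b ∈ f x × P x) xs → Any (λ x → b ∈ f x × Q x) xs → ∃ λ x → P x × Q x
  disjoint-meet {xs = x ∷ _} _ (here (_ , Px)) (here (_ , Qx)) = x , Px , Qx
  disjoint-meet (dx ∷ _) (here (b∈x , _)) (there q) with All.lookupAny dx q
  ... | disj , (b∈y , _) = contradiction (b∈x , b∈y) disj
  disjoint-meet (dx ∷ _) (there p) (here (b∈x , _)) with All.lookupAny dx p
  ... | disj , (b∈y , _) = contradiction (b∈x , b∈y) disj
  disjoint-meet (_ ∷ dxs) (there p) (there q) = disjoint-meet dxs p q

  focus : ∀ {x} {xs : List A} → x ∈ xs → ∃ λ rest → xs ↭ x ∷ rest
  focus x∈xs with ∈-∃++ x∈xs
  ... | ys , zs , refl = ys ++ zs , shift _ ys zs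

  any-∈-replace : ∀ {B : Set} (g : A → List B) {xs x x′ rest b z} → xs ↭ x ∷ rest → g x′ ↭ b ∷ g x →
                  Any (λ y → z ∈ g y) (x′ ∷ rest) ⇔ (z ≡ b ⊎ Any (λ y → z ∈ g y) xs)
  any-∈-replace g {xs} {x} {x′} {rest} {b} {z} σ σ′ = mk⇔ forth back
    where
    forth : Any (λ y → z ∈ g y) (x′ ∷ rest) → z ≡ b ⊎ Any (λ y → z ∈ g y) xs
    forth (here z∈x′) with ∈-resp-↭ σ′ z∈x′
    ... | here z≡b = inj₁ z≡b
    ... | there z∈x = inj₂ (Any-resp-↭ (↭-sym σ) (here z∈x))
    forth (there z∈rest) = inj₂ (Any-resp-↭ (↭-sym σ) (there z∈rest))
    back : z ≡ b ⊎ Any (λ y → z ∈ g y) xs → Any (λ y → z ∈ g y) (x′ ∷ rest)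
    back (inj₁ refl) = here (∈-resp-↭ (↭-sym σ′) (here refl))
    back (inj₂ z∈xs) with Any-resp-↭ σ z∈xs
    ... | here z∈x = here (∈-resp-↭ (↭-sym σ′) (there z∈x))
    ... | there z∈rest = there z∈rest

≤pred⇒< : ∀ {m n} → 1 ≤ m → m ≤ n ∸ 1 → m < n
≤pred⇒< {n = zero} (s≤s z≤n) ()
≤pred⇒< {n = suc n} _ m≤n = s≤s m≤n

%2≢0⇒≡1 : ∀ m → ¬ m % 2 ≡ 0 → m % 2 ≡ 1
%2≢0⇒≡1 zero m%2≢0 = contradiction refl m%2≢0
%2≢0⇒≡1 (suc zero) _ = refl
%2≢0⇒≡1 (suc (suc m)) m%2≢0 = %2≢0⇒≡1 m m%2≢0

EvenLength : {A : Set} → List A → Set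
EvenLength xs = length xs % 2 ≡ 0

odd-word⇒¬all-even : ∀ {A : Set} {ws : List (List A)} → Any (λ s → length s % 2 ≡ 1) ws → ¬ All EvenLength ws
odd-word⇒¬all-even odd all-even with All.lookupAny all-even odd
... | even , odd′ with trans (sym even) odd′
... | ()

-- EvenRunsAfter l bs: reading the delimiter flags bs after a pending run of l non-delimiters,
-- every maximal run of non-delimiters has even length.
EvenRunsAfter : ℕ → List Bool → Set
EvenRunsAfter l [] = l % 2 ≡ 0
EvenRunsAfter l (true ∷ bs) = l % 2 ≡ 0 × EvenRunsAfter 0 bs
EvenRunsAfter l (false ∷ bs) = EvenRunsAfter (suc l) bs

evenRunsAfter-2+ : ∀ l bs → EvenRunsAfter (2 + l) bs ⇔ EvenRunsAfter l bs
evenRunsAfter-2+ l [] = mk⇔ id id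
evenRunsAfter-2+ l (true ∷ bs) = mk⇔ id id
evenRunsAfter-2+ l (false ∷ bs) = evenRunsAfter-2+ (suc l) bs

module _ {A : Set} {P : Pred A 0ℓ} (P? : Decidable P) where

  private
    even-reverse : ∀ (xs : List A) → EvenLength (reverse xs) ⇔ EvenLength xs
    even-reverse xs = mk⇔ (trans (cong (_% 2) (sym (length-reverse xs))))
                          (trans (cong (_% 2) (length-reverse xs)))

  -- wordsBy runs a local accumulating worker; abstracting [] turns the defining equation into
  -- a pattern, from which unification solves wordsFrom as that worker.
  mutual
    wordsFrom : List A → List A → List (List A)
    wordsFrom = _

    wordsBy≡wordsFrom : ∀ xs → wordsBy P? xs ≡ wordsFrom [] xs
    wordsBy≡wordsFrom xs with List A ∋ []
    ... | acc = refl

  wordsFrom-even : ∀ acc cs →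
                   All EvenLength (wordsFrom acc cs) ⇔ EvenRunsAfter (length acc) (map (does ∘ P?) cs)
  wordsFrom-even [] [] = mk⇔ (λ _ → refl) (λ _ → [])
  wordsFrom-even (a ∷ as) [] =
    mk⇔ (λ { (even ∷ []) → to (even-reverse (a ∷ as)) even }) (λ even → from (even-reverse (a ∷ as)) even ∷ [])
  wordsFrom-even acc (c ∷ cs) with does (P? c)
  ... | false = wordsFrom-even (c ∷ acc) cs
  wordsFrom-even [] (c ∷ cs) | true =
    mk⇔ (λ evens → refl , to (wordsFrom-even [] cs) evens) (λ (_ , runs) → from (wordsFrom-even [] cs) runs)
  wordsFrom-even (a ∷ as) (c ∷ cs) | true =
    mk⇔ (λ { (even ∷ evens) → to (even-reverse (a ∷ as)) even , to (wordsFrom-even [] cs) evens })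
        (λ (even , runs) → from (even-reverse (a ∷ as)) even ∷ from (wordsFrom-even [] cs) runs)

  wordsBy-even : ∀ xs → All EvenLength (wordsBy P? xs) ⇔ EvenRunsAfter 0 (map (does ∘ P?) xs)
  wordsBy-even xs rewrite wordsBy≡wordsFrom xs = wordsFrom-even [] xs

-- Edges of a transversal as dominoes on its positions

End : ∀ {m} → Fin m → Fin (suc m) → Set
End e p = p ≡ inject₁ e ⊎ p ≡ fsuc e

-- Graph.Apart, for the edges of a transversal of any length.
Apart : ∀ {m} → Fin m → Fin m → Set
Apart a b = suc (toℕ a) < toℕ b ⊎ suc (toℕ b) < toℕ a

module _ {m : ℕ} where

  apart-sym : {a b : Fin m} → Apart a b → Apart b a
  apart-sym = swap

  apart-suc : {a b : Fin m} → Apart a b → Apart (fsuc a) (fsuc b)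
  apart-suc (inj₁ a<b) = inj₁ (s≤s a<b)
  apart-suc (inj₂ b<a) = inj₂ (s≤s b<a)

  end-suc : ∀ {e : Fin m} {p} → End e p → End (fsuc e) (fsuc p)
  end-suc (inj₁ refl) = inj₁ refl
  end-suc (inj₂ refl) = inj₂ refl

  end-suc⁻ : ∀ {e : Fin m} {p} → End (fsuc e) (fsuc p) → End e p
  end-suc⁻ (inj₁ eq) = inj₁ (fsuc-injective eq)
  end-suc⁻ (inj₂ eq) = inj₂ (fsuc-injective eq)

  end-bounds : ∀ {e : Fin m} {p} → End e p → toℕ e ≤ toℕ p × toℕ p ≤ suc (toℕ e)
  end-bounds {e} (inj₁ refl) rewrite toℕ-inject₁ e = ≤-refl , n≤1+n (toℕ e)
  end-bounds {e} (inj₂ refl) = n≤1+n (toℕ e) , ≤-refl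

  apart⇒no-common-end : ∀ {a b : Fin m} {p} → Apart a b → End a p → End b p → ⊥
  apart⇒no-common-end (inj₁ a<b) ap bp =
    <-irrefl refl (≤-trans a<b (≤-trans (proj₁ (end-bounds bp)) (proj₂ (end-bounds ap))))
  apart⇒no-common-end (inj₂ b<a) ap bp =
    <-irrefl refl (≤-trans b<a (≤-trans (proj₁ (end-bounds ap)) (proj₂ (end-bounds bp))))

  apart⇒≢ : {a b : Fin m} → Apart a b → ¬ a ≡ b
  apart⇒≢ ab refl = apart⇒no-common-end ab (inj₁ refl) (inj₁ refl)

  common-end⇒≡ : ∀ {E : List (Fin m)} {i j p} → AllPairs Apart E → i ∈ E → j ∈ E → End i p → End j p → i ≡ j
  common-end⇒≡ apart i∈ j∈ ip jp with allPairs-∈ apart i∈ j∈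
  ... | inj₁ i≡j = i≡j
  ... | inj₂ (inj₁ ij) = contradiction jp (apart⇒no-common-end ij ip)
  ... | inj₂ (inj₂ ji) = contradiction ip (apart⇒no-common-end ji jp)

  inject₁≢fsuc : ∀ (e : Fin m) → ¬ inject₁ e ≡ fsuc e
  inject₁≢fsuc e eq = 1+n≢n (trans (sym (cong toℕ eq)) (toℕ-inject₁ e))

  other-end : ∀ {e : Fin m} {p} → End e p → ∃ λ q → End e q × ¬ q ≡ p
  other-end {e} (inj₁ refl) = fsuc e , inj₂ refl , inject₁≢fsuc e ∘ sym
  other-end {e} (inj₂ refl) = inject₁ e , inj₁ refl , inject₁≢fsuc e

  ends : List (Fin m) → List (Fin (suc m))
  ends [] = []
  ends (e ∷ E) = inject₁ e ∷ fsuc e ∷ ends E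

  ∈-ends⁺ : ∀ {E e p} → e ∈ E → End e p → p ∈ ends E
  ∈-ends⁺ (here refl) (inj₁ refl) = here refl
  ∈-ends⁺ (here refl) (inj₂ refl) = there (here refl)
  ∈-ends⁺ (there e∈E) ep = there (there (∈-ends⁺ e∈E ep))

  ∈-ends⁻ : ∀ {E p} → p ∈ ends E → ∃ λ e → e ∈ E × End e p
  ∈-ends⁻ {e ∷ E} (here refl) = e , here refl , inj₁ refl
  ∈-ends⁻ {e ∷ E} (there (here refl)) = e , here refl , inj₂ refl
  ∈-ends⁻ {e ∷ E} (there (there p∈)) with ∈-ends⁻ p∈
  ... | f , f∈E , fp = f , there f∈E , fp

  length-ends : ∀ E → length (ends E) ≡ 2 * length E
  length-ends [] = refl
  length-ends (e ∷ E) = trans (cong (suc ∘ suc) (length-ends E)) (sym (*-suc 2 (length E)))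

  ends-unique : ∀ {E} → AllPairs Apart E → Unique (ends E)
  ends-unique {[]} [] = []
  ends-unique {e ∷ E} (apart-e ∷ apart-E) =
    (inject₁≢fsuc e ∷ All.tabulate (not-later (inj₁ refl))) ∷ All.tabulate (not-later (inj₂ refl)) ∷ ends-unique apart-E
    where
    not-later : ∀ {p q} → End e p → q ∈ ends E → ¬ p ≡ q
    not-later ep q∈ refl with ∈-ends⁻ q∈
    ... | f , f∈E , fq = apart⇒no-common-end (All.lookup apart-e f∈E) ep fq

-- Sets of pairwise non-consecutive edges

data Independent : ∀ {m} → Subset m → Set where
  []     : Independent []
  skip   : ∀ {m} {s : Subset m} → Independent s → Independent (outside ∷ s)
  single : Independent (inside ∷ [])
  pick   : ∀ {m} {s : Subset m} → Independent s → Independent (inside ∷ outside ∷ s)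

independents : ∀ m → List (Subset m)
independents zero = [] ∷ []
independents (suc zero) = (outside ∷ []) ∷ (inside ∷ []) ∷ []
independents (suc (suc m)) =
  map (outside ∷_) (independents (suc m)) ++ map (λ s → inside ∷ outside ∷ s) (independents m)

length-independents : ∀ m → length (independents m) ≡ fib (suc (suc m))
length-independents zero = refl
length-independents (suc zero) = refl
length-independents (suc (suc m)) =
  trans (length-++ (map (outside ∷_) (independents (suc m))))
        (cong₂ _+_ (trans (length-map _ (independents (suc m))) (length-independents (suc m)))
                   (trans (length-map _ (independents m)) (length-independents m)))

independents-unique : ∀ m → Unique (independents m)
independents-unique zero = [] ∷ []
independents-unique (suc zero) = ((λ ()) ∷ []) ∷ [] ∷ []
independents-unique (suc (suc m)) =
  Unique.++⁺ (Unique.map⁺ (λ { refl → refl }) (independents-unique (suc m)))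
             (Unique.map⁺ (λ { refl → refl }) (independents-unique m))
             first-differs
  where
  first-differs : Disjoint (map (outside ∷_) (independents (suc m))) (map (λ s → inside ∷ outside ∷ s) (independents m))
  first-differs (s∈₁ , s∈₂) with ∈-map⁻ (outside ∷_) s∈₁ | ∈-map⁻ (λ s → inside ∷ outside ∷ s) s∈₂
  ... | _ , _ , refl | _ , _ , ()

∈-independents : ∀ {m} {s : Subset m} → s ∈ independents m ⇔ Independent s
∈-independents = mk⇔ ∈⁻ ∈⁺
  where
  ∈⁻ : ∀ {m} {s : Subset m} → s ∈ independents m → Independent s
  ∈⁻ {zero} (here refl) = []
  ∈⁻ {suc zero} (here refl) = skip []
  ∈⁻ {suc zero} (there (here refl)) = single
  ∈⁻ {suc (suc m)} s∈ with Any.++⁻ (map (outside ∷_) (independents (suc m))) s∈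
  ... | inj₁ s∈₁ with ∈-map⁻ (outside ∷_) s∈₁
  ... | t , t∈ , refl = skip (∈⁻ t∈)
  ∈⁻ {suc (suc m)} s∈ | inj₂ s∈₂ with ∈-map⁻ (λ s → inside ∷ outside ∷ s) s∈₂
  ... | t , t∈ , refl = pick (∈⁻ t∈)
  ∈⁺ : ∀ {m} {s : Subset m} → Independent s → s ∈ independents m
  ∈⁺ [] = here refl
  ∈⁺ {suc zero} (skip []) = here refl
  ∈⁺ single = there (here refl)
  ∈⁺ {suc (suc m)} (skip i) = Any.++⁺ˡ (∈-map⁺ (outside ∷_) (∈⁺ i))
  ∈⁺ (pick i) = Any.++⁺ʳ (map (outside ∷_) (independents _)) (∈-map⁺ (λ s → inside ∷ outside ∷ s) (∈⁺ i))

-- For odd m the perfect matching of the path with m edges; it is the one independent edge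
-- set that is not Hamiltonian.
alternating : ∀ m → Subset m
alternating zero = []
alternating (suc zero) = inside ∷ []
alternating (suc (suc m)) = inside ∷ outside ∷ alternating m

alternating-independent : ∀ m → Independent (alternating m)
alternating-independent zero = []
alternating-independent (suc zero) = single
alternating-independent (suc (suc m)) = pick (alternating-independent m)

independent-size : ∀ {m} {s : Subset m} → Independent s → 2 * ∣ s ∣ ≤ suc m
independent-size [] = z≤n
independent-size (skip i) = m≤n⇒m≤1+n (independent-size i)
independent-size single = s≤s (s≤s z≤n)
independent-size {s = inside ∷ outside ∷ s} (pick i) rewrite *-suc 2 ∣ s ∣ = s≤s (s≤s (independent-size i))

independent-size-≢alternating : ∀ {m} {s : Subset m} → Independent s → ¬ s ≡ alternating m → 2 * ∣ s ∣ ≤ m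
independent-size-≢alternating [] s≢alt = contradiction refl s≢alt
independent-size-≢alternating (skip i) _ = independent-size i
independent-size-≢alternating single s≢alt = contradiction refl s≢alt
independent-size-≢alternating {s = inside ∷ outside ∷ s} (pick i) s≢alt rewrite *-suc 2 ∣ s ∣ =
  s≤s (s≤s (independent-size-≢alternating i (s≢alt ∘ cong (λ t → inside ∷ outside ∷ t))))

members : ∀ {m} → Subset m → List (Fin m)
members [] = []
members (inside ∷ s) = zero ∷ map fsuc (members s)
members (outside ∷ s) = map fsuc (members s)

∈-members : ∀ {m} {s : Subset m} {e} → e ∈ members s ⇔ e ∈ₛ s
∈-members = mk⇔ ∈⁻ ∈⁺
  where
  ∈⁻ : ∀ {m} {s : Subset m} {e} → e ∈ members s → e ∈ₛ s
  ∈⁻ {s = inside ∷ s} (here refl) = Vec.here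
  ∈⁻ {s = inside ∷ s} (there e∈) with ∈-map⁻ fsuc e∈
  ... | f , f∈ , refl = Vec.there (∈⁻ f∈)
  ∈⁻ {s = outside ∷ s} e∈ with ∈-map⁻ fsuc e∈
  ... | f , f∈ , refl = Vec.there (∈⁻ f∈)
  ∈⁺ : ∀ {m} {s : Subset m} {e} → e ∈ₛ s → e ∈ members s
  ∈⁺ {s = inside ∷ s} Vec.here = here refl
  ∈⁺ {s = inside ∷ s} (Vec.there e∈) = there (∈-map⁺ fsuc (∈⁺ e∈))
  ∈⁺ {s = outside ∷ s} (Vec.there e∈) = ∈-map⁺ fsuc (∈⁺ e∈)

length-members : ∀ {m} (s : Subset m) → length (members s) ≡ ∣ s ∣
length-members [] = refl
length-members (inside ∷ s) = cong suc (trans (length-map fsuc (members s)) (length-members s))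
length-members (outside ∷ s) = trans (length-map fsuc (members s)) (length-members s)

members-apart : ∀ {m} {s : Subset m} → Independent s → AllPairs Apart (members s)
members-apart [] = []
members-apart (skip i) = AllPairs.map⁺ (AllPairs.map apart-suc (members-apart i))
members-apart single = [] ∷ []
members-apart (pick i) =
  All.map⁺ (All.map⁺ (All.tabulate (λ _ → inj₁ (s≤s (s≤s z≤n)))))
  ∷ AllPairs.map⁺ (AllPairs.map⁺ (AllPairs.map (apart-suc ∘ apart-suc) (members-apart i)))

fromList : ∀ {m} → List (Fin m) → Subset m
fromList [] = ∅
fromList (e ∷ E) = ⁅ e ⁆ ∪ fromList E

∈-fromList : ∀ {m} {E : List (Fin m)} {e} → e ∈ E ⇔ e ∈ₛ fromList E
∈-fromList = mk⇔ ∈⁺ ∈⁻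
  where
  ∈⁺ : ∀ {m} {E : List (Fin m)} {e} → e ∈ E → e ∈ₛ fromList E
  ∈⁺ (here refl) = from ∪⇔⊎ (inj₁ (from x∈⁅y⁆⇔x≡y refl))
  ∈⁺ (there e∈) = from ∪⇔⊎ (inj₂ (∈⁺ e∈))
  ∈⁻ : ∀ {m} {E : List (Fin m)} {e} → e ∈ₛ fromList E → e ∈ E
  ∈⁻ {E = []} e∈ = contradiction e∈ ∉⊥
  ∈⁻ {E = f ∷ E} e∈ with to ∪⇔⊎ e∈
  ... | inj₁ e∈⁅f⁆ = here (to x∈⁅y⁆⇔x≡y e∈⁅f⁆)
  ... | inj₂ e∈E = there (∈⁻ e∈E)

independent⁺ : ∀ {m} {s : Subset m} → (∀ {i j p} → i ∈ₛ s → j ∈ₛ s → End i p → End j p → i ≡ j) → Independent s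
independent⁺ {s = []} _ = []
independent⁺ {s = outside ∷ s} shared-end⇒≡ =
  skip (independent⁺ λ i∈ j∈ ip jp →
    fsuc-injective (shared-end⇒≡ (Vec.there i∈) (Vec.there j∈) (end-suc ip) (end-suc jp)))
independent⁺ {s = inside ∷ []} _ = single
independent⁺ {s = inside ∷ inside ∷ s} shared-end⇒≡
  with shared-end⇒≡ Vec.here (Vec.there Vec.here) (inj₂ refl) (inj₁ refl)
... | ()
independent⁺ {s = inside ∷ outside ∷ s} shared-end⇒≡ =
  pick (independent⁺ λ i∈ j∈ ip jp →
    fsuc-injective (fsuc-injective (shared-end⇒≡ (Vec.there (Vec.there i∈)) (Vec.there (Vec.there j∈))
                                                  (end-suc (end-suc ip)) (end-suc (end-suc jp)))))

fromList-independent : ∀ {m} {E : List (Fin m)} → AllPairs Apart E → Independent (fromList E)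
fromList-independent {E = E} apart =
  independent⁺ λ i∈ j∈ → common-end⇒≡ apart (from (∈-fromList {E = E}) i∈) (from (∈-fromList {E = E}) j∈)

-- Tilings by independent edge sets

Covers : ∀ {m} → Subset m → Fin (suc m) → Set
Covers s p = ∃ λ e → e ∈ₛ s × End e p

covers⇔∈-ends : ∀ {m} {s : Subset m} {E} → (∀ {e} → e ∈ E ⇔ e ∈ₛ s) → ∀ {p} → Covers s p ⇔ p ∈ ends E
covers⇔∈-ends E≈s = mk⇔ (λ (e , e∈ , ep) → ∈-ends⁺ (from E≈s e∈) ep)
                       (λ p∈ → let e , e∈ , ep = ∈-ends⁻ p∈ in e , to E≈s e∈ , ep)

covers-suc : ∀ {m} {s : Subset m} {x p} → Covers s p → Covers (x ∷ s) (fsuc p)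
covers-suc (e , e∈ , ep) = fsuc e , Vec.there e∈ , end-suc ep

covers-outside⁻ : ∀ {m} {s : Subset m} {p} → Covers (outside ∷ s) (fsuc p) → Covers s p
covers-outside⁻ (fsuc e , Vec.there e∈ , ep) = e , e∈ , end-suc⁻ ep

¬covers-outside-zero : ∀ {m} {s : Subset m} → ¬ Covers (outside ∷ s) zero
¬covers-outside-zero (fsuc e , _ , inj₁ ())
¬covers-outside-zero (fsuc e , _ , inj₂ ())

covers-∷-suc-suc⁻ : ∀ {m} {s : Subset m} {x p} → Covers (x ∷ s) (fsuc (fsuc p)) → Covers s (fsuc p)
covers-∷-suc-suc⁻ (zero , _ , inj₁ ())
covers-∷-suc-suc⁻ (zero , _ , inj₂ ())
covers-∷-suc-suc⁻ (fsuc e , Vec.there e∈ , ep) = e , e∈ , end-suc⁻ ep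

covers-pick : ∀ {m} {s : Subset m} {p} → Covers (inside ∷ outside ∷ s) (fsuc (fsuc p)) ⇔ Covers s p
covers-pick = mk⇔ (covers-outside⁻ ∘ covers-∷-suc-suc⁻) (covers-suc ∘ covers-suc)

covers-inside-zero : ∀ {m} {s : Subset m} → Covers (inside ∷ s) zero
covers-inside-zero = zero , Vec.here , inj₁ refl

covers-inside-one : ∀ {m} {s : Subset m} → Covers (inside ∷ s) (fsuc zero)
covers-inside-one = zero , Vec.here , inj₂ refl

independent⇒evenRuns : ∀ {m} {s : Subset m} {D : Pred (Fin (suc m)) 0ℓ} (D? : Decidable D) →
                       Independent s → (∀ {p} → Covers s p ⇔ (¬ D p)) → EvenRunsAfter 0 (tabulate (does ∘ D?))
independent⇒evenRuns D? [] covers with D? zero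
... | yes _ = refl , refl
... | no ¬d with from covers ¬d
... | () , _ , _
independent⇒evenRuns D? (skip i) covers with D? zero
... | yes _ = refl , independent⇒evenRuns (D? ∘ fsuc) i (mk⇔ (to covers ∘ covers-suc) (covers-outside⁻ ∘ from covers))
... | no ¬d = ⊥-elim (¬covers-outside-zero (from covers ¬d))
independent⇒evenRuns D? single covers with D? zero | D? (fsuc zero)
... | yes d | _ = ⊥-elim (to covers covers-inside-zero d)
... | no _ | yes d = ⊥-elim (to covers covers-inside-one d)
... | no _ | no _ = refl
independent⇒evenRuns D? (pick i) covers with D? zero | D? (fsuc zero)
... | yes d | _ = ⊥-elim (to covers covers-inside-zero d)
... | no _ | yes d = ⊥-elim (to covers covers-inside-one d)
... | no _ | no _ =
  from (evenRunsAfter-2+ 0 (tabulate (does ∘ D? ∘ fsuc ∘ fsuc)))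
       (independent⇒evenRuns (D? ∘ fsuc ∘ fsuc) i (covers ⇔-∘ ⇔-sym covers-pick))

evenRuns⇒independent : ∀ {m} {D : Pred (Fin (suc m)) 0ℓ} (D? : Decidable D) → EvenRunsAfter 0 (tabulate (does ∘ D?)) →
                       ∃ λ (s : Subset m) → Independent s × (∀ {p} → Covers s p ⇔ (¬ D p))
evenRuns⇒independent {m} D? runs with D? zero
evenRuns⇒independent {zero} D? runs | yes d = [] , [] , λ { {zero} → mk⇔ (λ ()) (λ ¬d → ⊥-elim (¬d d)) }
evenRuns⇒independent {suc m} {D} D? (_ , runs) | yes d with evenRuns⇒independent (D? ∘ fsuc) runs
... | t , t-indep , covers = outside ∷ t , skip t-indep , covers′
  where
  covers′ : ∀ {p} → Covers (outside ∷ t) p ⇔ (¬ D p)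
  covers′ {zero} = mk⇔ (⊥-elim ∘ ¬covers-outside-zero) (λ ¬d → ⊥-elim (¬d d))
  covers′ {fsuc p} = mk⇔ (to covers ∘ covers-outside⁻) (covers-suc ∘ from covers)
evenRuns⇒independent {zero} D? () | no _
evenRuns⇒independent {suc m} D? runs | no ¬d₀ with D? (fsuc zero)
evenRuns⇒independent {suc m} D? () | no _ | yes _
evenRuns⇒independent {suc zero} {D} D? runs | no ¬d₀ | no ¬d₁ = inside ∷ [] , single , covers
  where
  covers : ∀ {p} → Covers (inside ∷ []) p ⇔ (¬ D p)
  covers {zero} = mk⇔ (λ _ → ¬d₀) (λ _ → covers-inside-zero)
  covers {fsuc zero} = mk⇔ (λ _ → ¬d₁) (λ _ → covers-inside-one)
evenRuns⇒independent {suc (suc m)} {D} D? runs | no ¬d₀ | no ¬d₁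
  with evenRuns⇒independent (D? ∘ fsuc ∘ fsuc) (to (evenRunsAfter-2+ 0 (tabulate (does ∘ D? ∘ fsuc ∘ fsuc))) runs)
... | t , t-indep , covers = inside ∷ outside ∷ t , pick t-indep , covers′
  where
  covers′ : ∀ {p} → Covers (inside ∷ outside ∷ t) p ⇔ (¬ D p)
  covers′ {zero} = mk⇔ (λ _ → ¬d₀) (λ _ → covers-inside-zero)
  covers′ {fsuc zero} = mk⇔ (λ _ → ¬d₁) (λ _ → covers-inside-one)
  covers′ {fsuc (fsuc p)} = covers ⇔-∘ covers-pick

alternating-covers : ∀ {m j} → suc m ≡ 2 * j → ∀ p → Covers (alternating m) p
alternating-covers {zero} {j} 1≡2j _ = contradiction (sym 1≡2j) (even≢odd j 0)
alternating-covers {suc zero} _ zero = covers-inside-zero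
alternating-covers {suc zero} _ (fsuc zero) = covers-inside-one
alternating-covers {suc (suc m)} _ zero = covers-inside-zero
alternating-covers {suc (suc m)} _ (fsuc zero) = covers-inside-one
alternating-covers {suc (suc m)} {suc j} eq (fsuc (fsuc p)) =
  from covers-pick (alternating-covers {j = j} (suc-injective (suc-injective (trans eq (*-suc 2 j)))) p)

-- The assembly graph of a double occurrence word

module Transversal {k n : ℕ} (w : Fin (suc k) → Fin n) (dbl : DoubleOccurrence w) where

  open Graph w hiding (Apart)

  private
    mate-spec : ∀ p → ∃ λ q → ¬ q ≡ p × w q ≡ w p × (∀ {x} → w x ≡ w p → x ≡ p ⊎ x ≡ q)
    mate-spec p with dbl (w p)
    ... | p₁ , p₂ , p₁≢p₂ , wp₁ , wp₂ , only with only p refl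
    ... | inj₁ refl = p₂ , p₁≢p₂ ∘ sym , wp₂ , only _
    ... | inj₂ refl = p₁ , p₁≢p₂ , wp₁ , swap ∘ only _

  mate : Fin (suc k) → Fin (suc k)
  mate p = proj₁ (mate-spec p)

  mate-≢ : ∀ p → ¬ mate p ≡ p
  mate-≢ p = proj₁ (proj₂ (mate-spec p))

  w-mate : ∀ p → w (mate p) ≡ w p
  w-mate p = proj₁ (proj₂ (proj₂ (mate-spec p)))

  same-letter : ∀ {p x} → w x ≡ w p → x ≡ p ⊎ x ≡ mate p
  same-letter {p} = proj₂ (proj₂ (proj₂ (mate-spec p)))

  mate-mate : ∀ p → mate (mate p) ≡ p
  mate-mate p with same-letter {p} (trans (w-mate (mate p)) (w-mate p))
  ... | inj₁ eq = eq
  ... | inj₂ eq = contradiction eq (mate-≢ (mate p))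

  endSeq-ends : ∀ E → endSeq E ≡ map w (ends E)
  endSeq-ends [] = refl
  endSeq-ends (e ∷ E) = cong (λ t → w (inject₁ e) ∷ w (fsuc e) ∷ t) (endSeq-ends E)

  positionsOf : Fin n → List (Fin (suc k)) → List (Fin (suc k))
  positionsOf v = filter (λ x → w x ≟ v)

  occurrences-map : ∀ v ps → occurrences v (map w ps) ≡ length (positionsOf v ps)
  occurrences-map v [] = refl
  occurrences-map v (x ∷ ps) with w x ≟ v
  ... | yes _ = cong suc (occurrences-map v ps)
  ... | no _ = occurrences-map v ps

  occurs-once⇐ : ∀ {ps p} → Unique ps → p ∈ ps → mate p ∉ ps → occurrences (w p) (map w ps) ≡ 1
  occurs-once⇐ {ps} {p} u p∈ps mate∉ps =
    trans (occurrences-map (w p) ps) (≤-antisym (length-≤-⊆ _≟_ (Unique.filter⁺ _ u) only-p) at-least-one)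
    where
    only-p : positionsOf (w p) ps ⊆ p ∷ []
    only-p x∈ with ∈-filter⁻ (λ x → w x ≟ w p) x∈
    ... | x∈ps , wx with same-letter wx
    ... | inj₁ refl = here refl
    ... | inj₂ refl = contradiction x∈ps mate∉ps
    at-least-one : 1 ≤ length (positionsOf (w p) ps)
    at-least-one = filter-some (λ x → w x ≟ w p) (Any.map (λ { refl → refl }) p∈ps)

  occurs-once⇒ : ∀ {v ps} → occurrences v (map w ps) ≡ 1 → ∃ λ p → p ∈ ps × w p ≡ v × mate p ∉ ps
  occurs-once⇒ {v} {ps} once with positionsOf v ps in eq | trans (sym (occurrences-map v ps)) once
  ... | p ∷ rest | length≡1 = p , proj₁ (at-v (here refl)) , proj₂ (at-v (here refl)) , mate∉ps
    where
    at-v : ∀ {x} → x ∈ p ∷ rest → x ∈ ps × w x ≡ v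
    at-v x∈ = ∈-filter⁻ (λ x → w x ≟ v) (subst (_ ∈_) (sym eq) x∈)
    mate∉ps : mate p ∉ ps
    mate∉ps mate∈ps =
      contradiction (≤-trans (length-≤-⊆ _≟_ both-unique both⊆) (≤-reflexive length≡1)) λ { (s≤s ()) }
      where
      both-unique : Unique (p ∷ mate p ∷ [])
      both-unique = ((mate-≢ p ∘ sym) ∷ []) ∷ [] ∷ []
      both⊆ : (p ∷ mate p ∷ []) ⊆ p ∷ rest
      both⊆ (here refl) = here refl
      both⊆ (there (here refl)) =
        subst (_ ∈_) eq (∈-filter⁺ (λ x → w x ≟ v) mate∈ps (trans (w-mate p) (proj₂ (at-v (here refl)))))

  occurs-zero⇐ : ∀ {ps p} → p ∉ ps → mate p ∉ ps → occurrences (w p) (map w ps) ≡ 0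
  occurs-zero⇐ {ps} {p} p∉ps mate∉ps =
    trans (occurrences-map (w p) ps) (cong length (filter-none (λ x → w x ≟ w p) (All.tabulate absent)))
    where
    absent : ∀ {x} → x ∈ ps → ¬ w x ≡ w p
    absent x∈ps wx with same-letter wx
    ... | inj₁ refl = p∉ps x∈ps
    ... | inj₂ refl = mate∉ps x∈ps

  occurs-zero⇒ : ∀ {ps p} → occurrences (w p) (map w ps) ≡ 0 → p ∉ ps
  occurs-zero⇒ {ps} {p} none p∈ps =
    contradiction (trans (sym (occurrences-map (w p) ps)) none)
                  (>⇒≢ (filter-some (λ x → w x ≟ w p) (Any.map (λ { refl → refl }) p∈ps)))

  mate-closed⇒¬once : ∀ {E v} → (∀ {p} → p ∈ ends E → mate p ∈ ends E) → ¬ occurrences v (endSeq E) ≡ 1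
  mate-closed⇒¬once {E} {v} closed once with occurs-once⇒ (subst (λ t → occurrences v t ≡ 1) (endSeq-ends E) once)
  ... | _ , p∈ , _ , mate∉ = mate∉ (closed p∈)

  joins-incident : ∀ {e a b u} → Joins e a b → Incident e u → u ≡ a ⊎ u ≡ b
  joins-incident (inj₁ (refl , refl)) (inj₁ refl) = inj₁ refl
  joins-incident (inj₁ (refl , refl)) (inj₂ refl) = inj₂ refl
  joins-incident (inj₂ (refl , refl)) (inj₁ refl) = inj₂ refl
  joins-incident (inj₂ (refl , refl)) (inj₂ refl) = inj₁ refl

  joins⇒incident : ∀ {e a b} → Joins e a b → Incident e a
  joins⇒incident (inj₁ (wa , _)) = inj₁ wa
  joins⇒incident (inj₂ (_ , wa)) = inj₂ wa

  incident-end : ∀ {e u} → Incident e u → ∃ λ p → EndAt e u p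
  incident-end {e} (inj₁ wu) = inject₁ e , inj₁ refl , wu
  incident-end {e} (inj₂ wu) = fsuc e , inj₂ refl , wu

  end-incident : ∀ {e p} → End e p → Incident e (w p)
  end-incident (inj₁ refl) = inj₁ refl
  end-incident (inj₂ refl) = inj₂ refl

  endAt-incident : ∀ {e u p} → EndAt e u p → Incident e u
  endAt-incident (ep , refl) = end-incident ep

  ends-joins : ∀ {e p q} → End e p → End e q → ¬ p ≡ q → Joins e (w p) (w q)
  ends-joins (inj₁ refl) (inj₁ refl) p≢q = contradiction refl p≢q
  ends-joins (inj₁ refl) (inj₂ refl) _ = inj₁ (refl , refl)
  ends-joins (inj₂ refl) (inj₁ refl) _ = inj₂ (refl , refl)
  ends-joins (inj₂ refl) (inj₂ refl) p≢q = contradiction refl p≢q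

  loop-free-end-unique : ∀ {e a b p q} → Joins e a b → ¬ a ≡ b → EndAt e a p → EndAt e a q → p ≡ q
  loop-free-end-unique _ _ (inj₁ refl , _) (inj₁ refl , _) = refl
  loop-free-end-unique _ _ (inj₂ refl , _) (inj₂ refl , _) = refl
  loop-free-end-unique (inj₁ (_ , wb)) a≢b (inj₁ refl , _) (inj₂ refl , wa) = contradiction (trans (sym wa) wb) a≢b
  loop-free-end-unique (inj₂ (wb , _)) a≢b (inj₁ refl , wa) (inj₂ refl , _) = contradiction (trans (sym wa) wb) a≢b
  loop-free-end-unique (inj₁ (_ , wb)) a≢b (inj₂ refl , wa) (inj₁ refl , _) = contradiction (trans (sym wa) wb) a≢b
  loop-free-end-unique (inj₂ (wb , _)) a≢b (inj₂ refl , _) (inj₁ refl , wa) = contradiction (trans (sym wa) wb) a≢b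

  chain-joins : ∀ {s e v xs} → Chain s ((e , v) ∷ xs) → Joins e s v
  chain-joins {xs = []} J = J
  chain-joins {xs = _ ∷ _} (J , _ , _) = J

  chain-rest : ∀ {s e v xs} → Chain s ((e , v) ∷ xs) → Chain v xs
  chain-rest {xs = []} _ = tt
  chain-rest {xs = _ ∷ _} (_ , _ , ch) = ch

  chain-incident : ∀ {s xs f u} → Chain s xs → f ∈ map proj₁ xs → Incident f u → u ∈ s ∷ map proj₂ xs
  chain-incident {xs = _ ∷ _} ch (here refl) inc with joins-incident (chain-joins ch) inc
  ... | inj₁ refl = here refl
  ... | inj₂ refl = there (here refl)
  chain-incident {xs = _ ∷ _} ch (there f∈) inc = there (chain-incident (chain-rest ch) f∈ inc)

  chain-first : ∀ {s e v xs f} → Chain s ((e , v) ∷ xs) → s ∉ v ∷ map proj₂ xs →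
                f ∈ e ∷ map proj₁ xs → Incident f s → f ≡ e
  chain-first _ _ (here refl) _ = refl
  chain-first ch s∉ (there f∈) inc = contradiction (chain-incident (chain-rest ch) f∈ inc) s∉

  start-end-unique : ∀ {s e v xs f p q} → Chain s ((e , v) ∷ xs) → Unique (s ∷ v ∷ map proj₂ xs) →
                     f ∈ e ∷ map proj₁ xs → EndAt f s q → EndAt e s p → q ≡ p
  start-end-unique ch u@((s≢v ∷ _) ∷ _) f∈ fq ep with chain-first ch (head∉ u) f∈ (endAt-incident fq)
  ... | refl = loop-free-end-unique (chain-joins ch) s≢v fq ep

  private
    first-meets-later : ∀ {s e v xs g p} → Chain s ((e , v) ∷ xs) → Unique (s ∷ v ∷ map proj₂ xs) →
                        g ∈ map proj₁ xs → End e p → End g p → ⊥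
    first-meets-later {xs = _ ∷ _} {g} {p} (J , nb , ch) u@(_ ∷ u′) g∈ ep gp with joins-incident J (end-incident ep)
    ... | inj₁ wp≡s = head∉ u (subst (_∈ _) wp≡s (chain-incident ch g∈ (end-incident gp)))
    ... | inj₂ wp≡v with chain-first ch (head∉ u′) g∈ (subst (Incident g) wp≡v (end-incident gp))
    ... | refl = nb p p (ep , wp≡v) (gp , wp≡v) refl

  chain-common-end : ∀ {s xs f g p} → Chain s xs → Unique (s ∷ map proj₂ xs) →
                     f ∈ map proj₁ xs → g ∈ map proj₁ xs → End f p → End g p → f ≡ g
  chain-common-end {xs = _ ∷ _} _ _ (here refl) (here refl) _ _ = refl
  chain-common-end {xs = _ ∷ _} ch u (here refl) (there g∈) fp gp = ⊥-elim (first-meets-later ch u g∈ fp gp)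
  chain-common-end {xs = _ ∷ _} ch u (there f∈) (here refl) fp gp = ⊥-elim (first-meets-later ch u f∈ gp fp)
  chain-common-end {xs = _ ∷ _} ch (_ ∷ u) (there f∈) (there g∈) fp gp =
    chain-common-end (chain-rest ch) u f∈ g∈ fp gp

  apart⇒neighbours : ∀ {u e f} → Apart e f → Neighbours u e f
  apart⇒neighbours ef _ _ (ep , _) (fq , _) refl = apart⇒no-common-end ef ep fq

  -- Both occurrences of an interior vertex are used by the path.
  interior-saturated : ∀ {s u u′ f f′ e} → Joins f s u → Neighbours u f f′ → Joins f′ u u′ →
                       Apart e f → Apart e f′ → ¬ Incident e u
  interior-saturated J nb J′ ef ef′ inc
    with incident-end (joins⇒incident (swap J)) | incident-end (joins⇒incident J′) | incident-end inc
  ... | p₁ , fp₁ | p₂ , fp₂ | p₃ , ep₃@(_ , wp₃)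
    with same-letter {p₁} (trans (proj₂ fp₂) (sym (proj₂ fp₁))) | same-letter {p₁} (trans wp₃ (sym (proj₂ fp₁)))
  ... | inj₁ refl | _ = nb p₁ p₁ fp₁ fp₂ refl
  ... | inj₂ _ | inj₁ refl = apart⇒no-common-end ef (proj₁ ep₃) (proj₁ fp₁)
  ... | inj₂ refl | inj₂ refl = apart⇒no-common-end ef′ (proj₁ ep₃) (proj₁ fp₂)

  prepend : (P : PolygonalPath) {e : Fin k} {v : Fin n} → v ∉ verts P → Joins e v (start P) →
            (∀ {f} → f ∈ edges P → Apart e f) → PolygonalPath
  prepend P {e} {v} v∉ J apart = record
    { start = v
    ; steps = (e , start P) ∷ steps P
    ; chain = chain′ (steps P) (chain P) apart
    ; distinct = All.¬Any⇒All¬ (verts P) v∉ ∷ distinct P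
    }
    where
    chain′ : ∀ xs → Chain (start P) xs → (∀ {f} → f ∈ map proj₁ xs → Apart e f) → Chain v ((e , start P) ∷ xs)
    chain′ [] _ _ = J
    chain′ (_ ∷ _) ch apart = J , apart⇒neighbours (apart (here refl)) , ch

  chain-snoc : ∀ {s xs u e v} → Chain s xs → u ∈ map proj₂ xs → Joins e u v →
               (∀ {f} → f ∈ map proj₁ xs → Apart e f) → Chain s (xs ++ (e , v) ∷ [])
  chain-snoc {xs = _ ∷ []} J₀ (here refl) J apart = J₀ , apart⇒neighbours (apart-sym (apart (here refl))) , J
  chain-snoc {xs = _ ∷ _ ∷ _} (J₀ , nb , ch) (here refl) J apart =
    ⊥-elim (interior-saturated J₀ nb (chain-joins ch) (apart (here refl)) (apart (there (here refl))) (joins⇒incident J))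
  chain-snoc {xs = _ ∷ _ ∷ _} (J₀ , nb , ch) (there u∈) J apart = J₀ , nb , chain-snoc ch u∈ J (apart ∘ there)

  extend : (P : PolygonalPath) {u v : Fin n} {e : Fin k} → u ∈ verts P → v ∉ verts P → Joins e v u →
           (∀ {f} → f ∈ edges P → Apart e f) →
           Σ PolygonalPath λ P′ → verts P′ ↭ v ∷ verts P × edges P′ ↭ e ∷ edges P
  extend P (here refl) v∉ J apart = prepend P v∉ J apart , ↭-refl , ↭-refl
  extend P {v = v} {e} (there u∈) v∉ J apart = P′ , verts-perm , edges-perm
    where
    P′ : PolygonalPath
    P′ = record
      { start = start P
      ; steps = steps P ++ (e , v) ∷ []
      ; chain = chain-snoc (chain P) u∈ (swap J) apart
      ; distinct = subst (Unique ∘ (start P ∷_)) (sym (map-++ proj₂ (steps P) _))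
                         (Unique.++⁺ (distinct P) ([] ∷ []) λ { (y∈ , here refl) → v∉ y∈ })
      }
    verts-perm : verts P′ ↭ v ∷ verts P
    verts-perm = ↭-trans (↭-reflexive (cong (start P ∷_) (map-++ proj₂ (steps P) _))) (↭-sym (∷↭∷ʳ v (verts P)))
    edges-perm : edges P′ ↭ e ∷ edges P
    edges-perm = ↭-trans (↭-reflexive (map-++ proj₁ (steps P) _)) (↭-sym (∷↭∷ʳ e (edges P)))

  vertexDisjoint-resp-↭ : ∀ {H H′} → H ↭ H′ → VertexDisjoint H → VertexDisjoint H′
  vertexDisjoint-resp-↭ σ = PermutationSetoid.AllPairs-resp-↭ (setoid PolygonalPath)
    Disjoint.sym (resp₂ (λ P Q → Disjoint (verts P) (verts Q))) (↭⇒↭ₛ σ)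

  edges-through : ∀ {H f u} → Any (λ P → f ∈ edges P) H → Incident f u → Any (λ P → u ∈ verts P × f ∈ edges P) H
  edges-through f∈H inc = Any.map (λ {P} f∈P → chain-incident (chain P) f∈P inc , f∈P) f∈H

  formPaths-[] : FormPaths []
  formPaths-[] = [] , [] , (λ _ → mk⇔ (λ ()) (λ ())) , (λ _ → mk⇔ (λ ()) (λ ()))

  formPaths-resp : ∀ {E E′} → (∀ {e} → e ∈ E ⇔ e ∈ E′) → FormPaths E → FormPaths E′
  formPaths-resp E≈E′ (H , disj , edges⇔ , verts⇔) =
    H , disj , (λ e → edges⇔ e ⇔-∘ ⇔-sym E≈E′) , (λ v → mk⇔ (transfer (to E≈E′) ∘ to (verts⇔ v)) (from (verts⇔ v) ∘ transfer (from E≈E′)))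
    where
    transfer : ∀ {v F F′} → (∀ {e} → e ∈ F → e ∈ F′) → Any (λ e → Incident e v) F → Any (λ e → Incident e v) F′
    transfer F⊆F′ inc = let e , e∈ , i = find inc in lose (F⊆F′ e∈) i

  private
    Grown : List PolygonalPath → Fin k → Set
    Grown H e = Σ (List PolygonalPath) λ H′ → VertexDisjoint H′ ×
      (∀ {x} → Any (λ P → x ∈ edges P) H′ ⇔ (x ≡ e ⊎ Any (λ P → x ∈ edges P) H)) ×
      (∀ {y} → Any (λ P → y ∈ verts P) H′ ⇔ (Incident e y ⊎ Any (λ P → y ∈ verts P) H))

    new-path : ∀ {H e u v} → VertexDisjoint H → Joins e v u → ¬ v ≡ u →
               ¬ Any (λ P → v ∈ verts P) H → ¬ Any (λ P → u ∈ verts P) H → Grown H e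
    new-path {H} {e} {u} {v} disj J v≢u v-uncovered u-uncovered =
      path ∷ H , All.tabulate path-disjoint ∷ disj ,
      mk⇔ (λ { (here (here x≡e)) → inj₁ x≡e ; (there x∈H) → inj₂ x∈H }) [ here ∘ here , there ]′ ,
      mk⇔ (λ { (here (here refl)) → inj₁ (joins⇒incident J)
             ; (here (there (here refl))) → inj₁ (joins⇒incident (swap J))
             ; (there y∈H) → inj₂ y∈H })
          [ (λ inc → here ([ here , there ∘ here ]′ (joins-incident J inc))) , there ]′
      where
      path : PolygonalPath
      path = record { start = v ; steps = (e , u) ∷ [] ; chain = J ; distinct = (v≢u ∷ []) ∷ [] ∷ [] }
      path-disjoint : ∀ {Q} → Q ∈ H → Disjoint (v ∷ u ∷ []) (verts Q)
      path-disjoint Q∈H (here refl , v∈Q) = v-uncovered (lose Q∈H v∈Q)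
      path-disjoint Q∈H (there (here refl) , u∈Q) = u-uncovered (lose Q∈H u∈Q)

    longer-path : ∀ {H e u v} → VertexDisjoint H → (∀ {f} → Any (λ P → f ∈ edges P) H → Apart e f) → Joins e v u →
                  ¬ Any (λ P → v ∈ verts P) H → Any (λ P → u ∈ verts P) H → Grown H e
    longer-path {H} {e} {v = v} disj apart J v-uncovered u-covered =
      P′ ∷ rest , All.tabulate P′-disjoint ∷ AllPairs.tail focused-disjoint ,
      any-∈-replace edges H↭ edges-perm ,
      mk⇔ ([ (λ { refl → inj₁ (joins⇒incident J) }) , inj₂ ]′ ∘ to (any-∈-replace verts H↭ verts-perm))
          (from (any-∈-replace verts H↭ verts-perm) ∘ [ new-or-old , inj₂ ]′)
      where
      P = proj₁ (find u-covered)
      P∈H = proj₁ (proj₂ (find u-covered))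
      u∈P = proj₂ (proj₂ (find u-covered))
      rest = proj₁ (focus P∈H)
      H↭ = proj₂ (focus P∈H)
      extended = extend P u∈P (v-uncovered ∘ lose P∈H) J (apart ∘ lose P∈H)
      P′ = proj₁ extended
      verts-perm = proj₁ (proj₂ extended)
      edges-perm = proj₂ (proj₂ extended)
      focused-disjoint = vertexDisjoint-resp-↭ H↭ disj
      P′-disjoint : ∀ {Q} → Q ∈ rest → Disjoint (verts P′) (verts Q)
      P′-disjoint Q∈rest (y∈P′ , y∈Q) with ∈-resp-↭ verts-perm y∈P′
      ... | here refl = v-uncovered (Any-resp-↭ (↭-sym H↭) (there (lose Q∈rest y∈Q)))
      ... | there y∈P = All.lookup (AllPairs.head focused-disjoint) Q∈rest (y∈P , y∈Q)
      new-or-old : ∀ {y} → Incident e y → y ≡ v ⊎ Any (λ Q → y ∈ verts Q) H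
      new-or-old inc with joins-incident J inc
      ... | inj₁ refl = inj₁ refl
      ... | inj₂ refl = inj₂ (lose P∈H u∈P)

    grown⇒formPaths : ∀ {E e H} → (∀ x → (x ∈ E) ⇔ Any (λ P → x ∈ edges P) H) →
                      (∀ y → Any (λ P → y ∈ verts P) H ⇔ Any (λ f → Incident f y) E) → Grown H e → FormPaths (e ∷ E)
    grown⇒formPaths {E} {e} edges⇔ verts⇔ (H′ , disj′ , edges′ , verts′) =
      H′ , disj′ ,
      (λ x → mk⇔ (from edges′ ∘ map₂ (to (edges⇔ x)) ∘ ∈-∷⁻) ([ here , there ∘ from (edges⇔ x) ]′ ∘ to edges′)) ,
      (λ y → mk⇔ ([ here , there ∘ to (verts⇔ y) ]′ ∘ to verts′) (from verts′ ∘ map₂ (from (verts⇔ y)) ∘ any-∷⁻))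
      where
      ∈-∷⁻ : ∀ {x} → x ∈ e ∷ E → x ≡ e ⊎ x ∈ E
      ∈-∷⁻ (here x≡e) = inj₁ x≡e
      ∈-∷⁻ (there x∈E) = inj₂ x∈E
      any-∷⁻ : ∀ {y} → Any (λ f → Incident f y) (e ∷ E) → Incident e y ⊎ Any (λ f → Incident f y) E
      any-∷⁻ (here inc) = inj₁ inc
      any-∷⁻ (there inc) = inj₂ inc

  attach : ∀ {E e u v} → FormPaths E → (∀ {f} → f ∈ E → Apart e f) → Joins e v u → ¬ v ≡ u →
           (∀ {f} → f ∈ E → ¬ Incident f v) → FormPaths (e ∷ E)
  attach {e = e} {u} {v} (H , disj , edges⇔ , verts⇔) apart J v≢u v-free =
    grown⇒formPaths edges⇔ verts⇔ (grow (Any.any? (λ P → Any.any? (u ≟_) (verts P)) H))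
    where
    v-uncovered : ¬ Any (λ P → v ∈ verts P) H
    v-uncovered v∈H = let f , f∈E , inc = find (to (verts⇔ v) v∈H) in v-free f∈E inc
    grow : Dec (Any (λ P → u ∈ verts P) H) → Grown H e
    grow (no u-uncovered) = new-path disj J v≢u v-uncovered u-uncovered
    grow (yes u-covered) = longer-path disj (apart ∘ from (edges⇔ _)) J v-uncovered u-covered

  endpoint-occurs-once : ∀ {E e₀} (H : List PolygonalPath) → VertexDisjoint H →
                         (∀ e → (e ∈ E) ⇔ Any (λ P → e ∈ edges P) H) → AllPairs Apart E → e₀ ∈ E →
                         ∃ λ v → occurrences v (endSeq E) ≡ 1
  endpoint-occurs-once {E} {e₀} H disj edges⇔ apart e₀∈E with find (to (edges⇔ e₀) e₀∈E)
  ... | P , P∈H , e₀∈P with P | e₀∈P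
  ... | record { steps = [] } | ()
  ... | P′@record { start = s ; steps = (e₁ , v₁) ∷ xs ; chain = ch ; distinct = u } | _ =
    w p , subst (λ t → occurrences (w p) t ≡ 1) (sym (endSeq-ends E)) (occurs-once⇐ (ends-unique apart) p∈ mate∉)
    where
    p = proj₁ (incident-end (joins⇒incident (chain-joins ch)))
    e₁p = proj₂ (incident-end (joins⇒incident (chain-joins ch)))
    p∈ : p ∈ ends E
    p∈ = ∈-ends⁺ (from (edges⇔ e₁) (lose P∈H (here refl))) (proj₁ e₁p)
    at-s : ∀ {f} → End f (mate p) → EndAt f s (mate p)
    at-s f-mate = f-mate , trans (w-mate p) (proj₂ e₁p)
    mate∉ : mate p ∉ ends E
    mate∉ mate∈ with ∈-ends⁻ mate∈
    ... | f , f∈E , f-mate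
      with disjoint-meet {Q = _≡ P′} disj (edges-through (to (edges⇔ f) f∈E) (endAt-incident (at-s f-mate)))
                                         (Any.map (λ { refl → here refl , refl }) P∈H)
    ... | _ , f∈P , refl = mate-≢ p (start-end-unique ch u f∈P (at-s f-mate) e₁p)

  hamiltonian-independent : ∀ {S} → HamiltonianEdgeSet S → Independent S
  hamiltonian-independent {S} (H , (disj , _) , edges⇔) = independent⁺ shared-end⇒≡
    where
    shared-end⇒≡ : ∀ {i j p} → i ∈ₛ S → j ∈ₛ S → End i p → End j p → i ≡ j
    shared-end⇒≡ {i} {j} i∈S j∈S ip jp
      with disjoint-meet disj (edges-through (to (edges⇔ i) i∈S) (end-incident ip))
                              (edges-through (to (edges⇔ j) j∈S) (end-incident jp))
    ... | Q , i∈Q , j∈Q = chain-common-end (chain Q) (distinct Q) i∈Q j∈Q ip jp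

  point : Fin n → PolygonalPath
  point v = record { start = v ; steps = [] ; chain = tt ; distinct = [] ∷ [] }

  formPaths⇒hamiltonian : ∀ {E S} → (∀ {e} → e ∈ E ⇔ e ∈ₛ S) → FormPaths E → HamiltonianEdgeSet S
  formPaths⇒hamiltonian E≈S (H , disj , edges⇔ , _) =
    H ++ map point isolated , (disj′ , cover) , λ e → edges′ ⇔-∘ (edges⇔ e ⇔-∘ ⇔-sym E≈S)
    where
    covered? : Decidable (λ v → Any (λ P → v ∈ verts P) H)
    covered? v = Any.any? (λ P → Any.any? (v ≟_) (verts P)) H
    isolated : List (Fin n)
    isolated = filter (¬? ∘ covered?) (allFin n)
    points-disjoint : ∀ {a b} → ¬ a ≡ b → Disjoint (verts (point a)) (verts (point b))
    points-disjoint a≢b (here refl , here refl) = a≢b refl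
    isolated-disjoint : ∀ {P v} → P ∈ H → v ∈ isolated → Disjoint (verts P) (verts (point v))
    isolated-disjoint P∈H v∈ (y∈P , here refl) = proj₂ (∈-filter⁻ (¬? ∘ covered?) {xs = allFin n} v∈) (lose P∈H y∈P)
    disj′ : VertexDisjoint (H ++ map point isolated)
    disj′ = AllPairs.++⁺ disj
              (AllPairs.map⁺ (AllPairs.map points-disjoint (Unique.filter⁺ (¬? ∘ covered?) (Unique.allFin⁺ n))))
              (All.tabulate λ P∈H → All.map⁺ (All.tabulate (isolated-disjoint P∈H)))
    cover : ∀ v → Any (λ P → v ∈ verts P) (H ++ map point isolated)
    cover v with covered? v
    ... | yes v∈H = Any.++⁺ˡ v∈H
    ... | no v∉H = Any.++⁺ʳ H (Any.map⁺ (lose (∈-filter⁺ (¬? ∘ covered?) (∈-allFin v) v∉H) (here refl)))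
    points-edgeless : ∀ {e vs} → ¬ Any (λ P → e ∈ edges P) (map point vs)
    points-edgeless e∈points with find (Any.map⁻ e∈points)
    ... | _ , _ , ()
    edges′ : ∀ {e} → Any (λ P → e ∈ edges P) H ⇔ Any (λ P → e ∈ edges P) (H ++ map point isolated)
    edges′ = mk⇔ Any.++⁺ˡ ([ id , ⊥-elim ∘ points-edgeless ]′ ∘ Any.++⁻ H)

  -- A vertex occurring once is the free end of an edge e; the paths formed by the other
  -- edges extend along e.
  cond3⇒formPaths : Cond3 → ∀ l E → length E ≡ l → AllPairs Apart E → l ≤ n ∸ 1 → FormPaths E
  cond3⇒formPaths _ _ [] _ _ _ = formPaths-[]
  cond3⇒formPaths c3 (suc l) E@(_ ∷ _) len apart small with c3 (suc l) (s≤s z≤n) small E (apart , len)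
  ... | v , once with occurs-once⇒ (subst (λ t → occurrences v t ≡ 1) (endSeq-ends E) once)
  ... | p , p∈ , wp , mate∉ with ∈-ends⁻ p∈
  ... | e , e∈E , ep with other-end ep
  ... | q , eq , q≢p =
    formPaths-resp (∷-remove _≟_ e∈E) (attach rest-paths apart-e J v≢wq v-free)
    where
    rest-paths : FormPaths (remove _≟_ e E)
    rest-paths = cond3⇒formPaths c3 l (remove _≟_ e E)
      (suc-injective (trans (length-remove _≟_ (AllPairs.map apart⇒≢ apart) e∈E) len))
      (AllPairs.filter⁺ (λ f → ¬? (f ≟ e)) apart) (≤-trans (n≤1+n l) small)
    J : Joins e v (w q)
    J = subst (λ z → Joins e z (w q)) wp (ends-joins ep eq (q≢p ∘ sym))
    v≢wq : ¬ v ≡ w q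
    v≢wq v≡wq with same-letter {p} (trans (sym v≡wq) (sym wp))
    ... | inj₁ q≡p = q≢p q≡p
    ... | inj₂ refl = mate∉ (∈-ends⁺ e∈E eq)
    apart-e : ∀ {f} → f ∈ remove _≟_ e E → Apart e f
    apart-e f∈ with ∈-remove⁻ _≟_ f∈
    ... | f∈E , f≢e with allPairs-∈ apart e∈E f∈E
    ... | inj₁ refl = contradiction refl f≢e
    ... | inj₂ (inj₁ ef) = ef
    ... | inj₂ (inj₂ fe) = apart-sym fe
    v-free : ∀ {f} → f ∈ remove _≟_ e E → ¬ Incident f v
    v-free f∈ inc with ∈-remove⁻ _≟_ f∈ | incident-end inc
    ... | f∈E , f≢e | r , fr , wr with same-letter {p} (trans wr (sym wp))
    ... | inj₁ refl = f≢e (common-end⇒≡ apart f∈E e∈E fr ep)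
    ... | inj₂ refl = mate∉ (∈-ends⁺ f∈E fr)

  cond2⇒cond3 : Cond2 → Cond3
  cond2⇒cond3 c2 m 1≤m m≤ E (apart , len) with c2 m 1≤m m≤ E (apart , len) | 1≤length⇒∈ 1≤m len
  ... | H , disj , edges⇔ , _ | e₀ , e₀∈E = endpoint-occurs-once H disj edges⇔ apart e₀∈E

  cond3⇒cond2 : Cond3 → Cond2
  cond3⇒cond2 c3 m _ m≤ E (apart , len) = cond3⇒formPaths c3 m E len apart m≤

  cond2⇒formPaths : Cond2 → ∀ {E} → AllPairs Apart E → length E ≤ n ∸ 1 → FormPaths E
  cond2⇒formPaths _ {[]} _ _ = formPaths-[]
  cond2⇒formPaths c2 {E@(_ ∷ _)} apart small = c2 (length E) (s≤s z≤n) small E (apart , refl)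

  deleteLetters-even : ∀ σ → All EvenLength (deleteLetters σ) ⇔ EvenRunsAfter 0 (tabulate (λ p → does (w p ∈ₛ? σ)))
  deleteLetters-even σ = subst (λ bs → All EvenLength (deleteLetters σ) ⇔ EvenRunsAfter 0 bs)
                               (map-tabulate w (does ∘ (_∈ₛ? σ))) (wordsBy-even (_∈ₛ? σ) word)

  module _ (k+1≡2n : suc k ≡ 2 * n) where

    covering⇒n≤length : ∀ {E} → (∀ p → p ∈ ends E) → n ≤ length E
    covering⇒n≤length {E} covering = *-cancelˡ-≤ 2 (begin
      2 * n                      ≡⟨ sym k+1≡2n ⟩
      suc k                      ≡⟨ sym (length-tabulate id) ⟩
      length (allFin (suc k))    ≤⟨ length-≤-⊆ _≟_ (Unique.allFin⁺ (suc k)) (λ {p} _ → covering p) ⟩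
      length (ends E)            ≡⟨ length-ends E ⟩
      2 * length E               ∎)
      where open ≤-Reasoning

    small⇒¬covering : ∀ {E m} → 1 ≤ m → m ≤ n ∸ 1 → length E ≡ m → ¬ (∀ p → p ∈ ends E)
    small⇒¬covering 1≤m m≤ len covering =
      <-irrefl refl (≤-trans (≤pred⇒< 1≤m m≤) (subst (n ≤_) len (covering⇒n≤length covering)))

    small-independent : ∀ {S} → Independent S → ¬ S ≡ alternating k → length (members S) ≤ n ∸ 1
    small-independent {S} S-indep S≢alt = <⇒≤pred (*-cancelˡ-< 2 (length (members S)) n (begin-strict
      2 * length (members S)     ≡⟨ cong (2 *_) (length-members S) ⟩
      2 * ∣ S ∣                  ≤⟨ independent-size-≢alternating S-indep S≢alt ⟩
      k                          <⟨ ≤-refl ⟩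
      suc k                      ≡⟨ k+1≡2n ⟩
      2 * n                      ∎))
      where open ≤-Reasoning

    alternating-ends : ∀ p → p ∈ ends (members (alternating k))
    alternating-ends p = to (covers⇔∈-ends ∈-members) (alternating-covers {j = n} k+1≡2n p)

    hamiltonian-≢alternating : ∀ {S} → HamiltonianEdgeSet S → ¬ S ≡ alternating k
    hamiltonian-≢alternating (H , (disj , _) , edges⇔) refl =
      let e₀ , e₀∈E , _ = ∈-ends⁻ (alternating-ends zero)
          v , once = endpoint-occurs-once H disj (λ e → edges⇔ e ⇔-∘ ∈-members)
                                          (members-apart (alternating-independent k)) e₀∈E
      in mate-closed⇒¬once (λ {p} _ → alternating-ends (mate p)) once

    candidates : List (Subset k)
    candidates = remove (≡-dec Bool._≟_) (alternating k) (independents k)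

    ∈-candidates : ∀ {S} → S ∈ candidates ⇔ (Independent S × ¬ S ≡ alternating k)
    ∈-candidates = mk⇔
      (λ S∈ → let S∈ind , S≢alt = ∈-remove⁻ (≡-dec Bool._≟_) S∈ in to ∈-independents S∈ind , S≢alt)
      (λ (S-indep , S≢alt) → ∈-remove⁺ (≡-dec Bool._≟_) (from ∈-independents S-indep) S≢alt)

    length-candidates : length candidates ≡ fib (2 * n + 1) ∸ 1
    length-candidates = begin
      length candidates                ≡⟨⟩
      suc (length candidates) ∸ 1      ≡⟨ cong (_∸ 1) (length-remove (≡-dec Bool._≟_) (independents-unique k)
                                                        (from ∈-independents (alternating-independent k))) ⟩
      length (independents k) ∸ 1      ≡⟨ cong (_∸ 1) (length-independents k) ⟩
      fib (suc (suc k)) ∸ 1            ≡⟨ cong (λ m → fib m ∸ 1) (trans (cong suc k+1≡2n) (+-comm 1 (2 * n))) ⟩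
      fib (2 * n + 1) ∸ 1              ∎
      where open ≡-Reasoning

    hamiltonian⇒candidate : ∀ {S} → HamiltonianEdgeSet S → S ∈ candidates
    hamiltonian⇒candidate ham = from ∈-candidates (hamiltonian-independent ham , hamiltonian-≢alternating ham)

    cond2⇒cond1 : Cond2 → Cond1
    cond2⇒cond1 c2 =
      candidates , Unique.filter⁺ _ (independents-unique k) ,
      (λ S → mk⇔ candidate⇒hamiltonian hamiltonian⇒candidate) , length-candidates
      where
      candidate⇒hamiltonian : ∀ {S} → S ∈ candidates → HamiltonianEdgeSet S
      candidate⇒hamiltonian S∈ with to ∈-candidates S∈
      ... | S-indep , S≢alt = formPaths⇒hamiltonian ∈-members
                                (cond2⇒formPaths c2 (members-apart S-indep) (small-independent S-indep S≢alt))

    cond1⇒cond3 : Cond1 → Cond3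
    cond1⇒cond3 (L , L-unique , L⇔ , L-length) m 1≤m m≤ E (apart , len)
      with to (L⇔ (fromList E)) (candidates⊆L (from ∈-candidates (fromList-independent apart , E≢alt)))
      where
      candidates⊆L : candidates ⊆ L
      candidates⊆L = ⊇-by-length (≡-dec Bool._≟_) L-unique
        (λ {S} S∈L → hamiltonian⇒candidate (to (L⇔ S) S∈L))
        (≤-reflexive (trans length-candidates (sym L-length)))
      E≢alt : ¬ fromList E ≡ alternating k
      E≢alt E≡alt = small⇒¬covering {E} 1≤m m≤ len λ p →
        to (covers⇔∈-ends (∈-fromList {E = E})) (subst (λ S → Covers S p) (sym E≡alt) (alternating-covers {j = n} k+1≡2n p))
    ... | H , (disj , _) , edges⇔ =
      endpoint-occurs-once H disj (λ e → edges⇔ e ⇔-∘ ∈-fromList {E = E}) apart (proj₂ (1≤length⇒∈ 1≤m len))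

    cond3⇒cond4 : Cond3 → Cond4
    cond3⇒cond4 c3 σ (v₀ , v₀∈σ) (v₁ , v₁∉σ) with All.all? (λ s → length s % 2 ≟ℕ 0) (deleteLetters σ)
    ... | no not-all-even = Any.map (λ {s} → %2≢0⇒≡1 (length s)) (All.¬All⇒Any¬ (λ s → length s % 2 ≟ℕ 0) _ not-all-even)
    ... | yes all-even with evenRuns⇒independent (λ p → w p ∈ₛ? σ) (to (deleteLetters-even σ) all-even)
    ... | S , S-indep , covers =
      let v , once = c3 (length (members S)) (∈⇒1≤length (proj₁ (proj₂ (∈-ends⁻ (position-covered v₁∉σ)))))
                        (small-independent S-indep S≢alt) (members S) (members-apart S-indep , refl)
      in ⊥-elim (mate-closed⇒¬once closed once)
      where
      covered : ∀ {p} → p ∈ ends (members S) ⇔ (w p ∉ₛ σ)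
      covered = covers ⇔-∘ ⇔-sym (covers⇔∈-ends ∈-members)
      closed : ∀ {p} → p ∈ ends (members S) → mate p ∈ ends (members S)
      closed {p} p∈ = from covered (subst (_∉ₛ σ) (sym (w-mate p)) (to covered p∈))
      position : Fin n → Fin (suc k)
      position v = proj₁ (dbl v)
      w-position : ∀ v → w (position v) ≡ v
      w-position v = proj₁ (proj₂ (proj₂ (proj₂ (dbl v))))
      position-covered : ∀ {v} → v ∉ₛ σ → position v ∈ ends (members S)
      position-covered {v} v∉σ = from covered (subst (_∉ₛ σ) (sym (w-position v)) v∉σ)
      S≢alt : ¬ S ≡ alternating k
      S≢alt refl = to covered (alternating-ends (position v₀)) (subst (_∈ₛ σ) (sym (w-position v₀)) v₀∈σ)

    cond4⇒cond3 : Cond4 → Cond3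
    cond4⇒cond3 c4 m 1≤m m≤ E (apart , len) with any? (λ v → occurrences v (endSeq E) ≟ℕ 1)
    ... | yes once = once
    ... | no no-once = ⊥-elim (odd-word⇒¬all-even (c4 σ σ-nonempty σ-proper) all-even)
      where
      unused? : Decidable (λ v → occurrences v (map w (ends E)) ≡ 0)
      unused? v = occurrences v (map w (ends E)) ≟ℕ 0
      σ : Subset n
      σ = fromList (filter unused? (allFin n))
      ∈σ⇔ : ∀ {v} → v ∈ₛ σ ⇔ occurrences v (map w (ends E)) ≡ 0
      ∈σ⇔ {v} = mk⇔ (proj₂ ∘ ∈-filter⁻ unused? {xs = allFin n} ∘ from (∈-fromList {E = filter unused? (allFin n)}))
                    (to (∈-fromList {E = filter unused? (allFin n)}) ∘ ∈-filter⁺ unused? (∈-allFin v))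
      uncovered⇒∈σ : ∀ {p} → p ∉ ends E → w p ∈ₛ σ
      uncovered⇒∈σ {p} p∉ with Any.any? (mate p ≟_) (ends E)
      ... | no mate∉ = from ∈σ⇔ (occurs-zero⇐ p∉ mate∉)
      ... | yes mate∈ = ⊥-elim (no-once (w p , subst (λ t → occurrences (w p) t ≡ 1) (sym (endSeq-ends E))
                          (subst (λ v → occurrences v (map w (ends E)) ≡ 1) (w-mate p)
                            (occurs-once⇐ (ends-unique apart) mate∈ (subst (_∉ ends E) (sym (mate-mate p)) p∉)))))
      covered : ∀ {p} → p ∈ ends E ⇔ (w p ∉ₛ σ)
      covered {p} = mk⇔ (λ p∈ wp∈σ → occurs-zero⇒ (to ∈σ⇔ wp∈σ) p∈)
                        (λ wp∉σ → decidable-stable (Any.any? (p ≟_) (ends E)) (wp∉σ ∘ uncovered⇒∈σ))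
      all-even : All EvenLength (deleteLetters σ)
      all-even = from (deleteLetters-even σ)
        (independent⇒evenRuns (λ p → w p ∈ₛ? σ) (fromList-independent apart) (covered ⇔-∘ covers⇔∈-ends (∈-fromList {E = E})))
      σ-nonempty : Nonempty σ
      σ-nonempty with nonempty? σ
      ... | yes ne = ne
      ... | no empty = ⊥-elim (small⇒¬covering {E} 1≤m m≤ len λ p → from covered (λ wp∈σ → empty (w p , wp∈σ)))
      σ-proper : ∃ λ v → v ∉ₛ σ
      σ-proper = let e₀ , e₀∈E = 1≤length⇒∈ 1≤m len in w (inject₁ e₀) , to covered (∈-ends⁺ e₀∈E (inj₁ refl))

proposition3p6 : (n k : ℕ) → suc k ≡ 2 * n → (w : Fin (suc k) → Fin n) → DoubleOccurrence w →
    let open Graph w in (Cond1 ⇔ Cond2) × (Cond2 ⇔ Cond3) × (Cond3 ⇔ Cond4)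
proposition3p6 n k k+1≡2n w dbl =
  mk⇔ (cond3⇒cond2 ∘ cond1⇒cond3 k+1≡2n) (cond2⇒cond1 k+1≡2n) ,
  mk⇔ cond2⇒cond3 cond3⇒cond2 ,
  mk⇔ (cond3⇒cond4 k+1≡2n) (cond4⇒cond3 k+1≡2n)
  where open Transversal w dbl
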